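{- Let $q$ be a prime power and $1\le\ell\le m$ integers. The nonzero weights of $\hat C_{\det}(1;\ell,m)$ are $\hat w_1,\dots,\hat w_\ell$, given by $$\hat w_r=w_H(\hat c_{\tau_r})=q^{\ell+m-2}+q^{\ell+m-3}+\cdots+q^{\ell+m-r-1}=q^{\ell+m-r-1}\frac{q^r-1}{q-1}$$ for $r=1,\dots,\ell$, where $\tau_r=X_{11}+\cdots+X_{rr}$. In particular $\hat w_1<\hat w_2<\cdots<\hat w_\ell$ and the minimum distance of $\hat C_{\det}(1;\ell,m)$ is $q^{\ell+m-2}$.
   Context: $\mathbb{F}_q$ is the finite field with $q$ elements; $X=(X_{ij})$ is an $\ell\times m$ matrix of indeterminates; $\mathbb{F}_q[X]_1$ is the space of linear homogeneous polynomials $f=\sum f_{ij}X_{ij}$ (with $0$), evaluated at a matrix $M$ by $f(M)=\sum f_{ij}M_{ij}$. Let $\hat M_1,\dots,\hat M_{\hat n}$ be representatives, one from each class of nonzero scalar multiples, of the matrices in $M_{\ell\times m}(\mathbb{F}_q)$ of rank exactly $1$; $\hat c_f=(f(\hat M_1),\dots,f(\hat M_{\hat n}))$ and $\hat C_{\det}(1;\ell,m)=\{\hat c_f:f\in\mathbb{F}_q[X]_1\}\subseteq\mathbb{F}_q^{\hat n}$. $w_H$ denotes Hamming weight. -}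

module Defs where

open import Level using (0ℓ)
open import Data.Nat as ℕ using (ℕ; zero; suc; _^_; _∸_; _≤_)
open import Data.Fin using (Fin; toℕ)
open import Data.Fin.Base using () renaming (zero to fz; suc to fs)
open import Data.Product using (Σ; ∃; ∃-syntax; _×_; _,_)
open import Data.Nat.Primality using (Prime)
open import Function.Bundles using (_↔_)
open import Relation.Nullary using (¬_; Dec; yes; no)
open import Relation.Nullary.Decidable using (_×-dec_)
open import Relation.Binary.PropositionalEquality using (_≡_; _≢_)
open import Relation.Binary.Definitions using (DecidableEquality)
open import Algebra.Structures using (IsCommutativeRing)

IsPrimePower : ℕ → Set
IsPrimePower q = Σ ℕ λ p → Σ ℕ λ k → Prime p × 1 ≤ k × q ≡ p ^ k

record FiniteField (q : ℕ) : Set₁ where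
  infixl 6 _+_
  infixl 7 _*_
  field
    Carrier : Set
    _+_ _*_ : Carrier → Carrier → Carrier
    -_ : Carrier → Carrier
    0# 1# : Carrier
    isCommutativeRing : IsCommutativeRing _≡_ _+_ _*_ -_ 0# 1#
    _≟_ : DecidableEquality Carrier
    0≢1 : 0# ≢ 1#
    inverse : (x : Carrier) → x ≢ 0# → Σ Carrier λ y → x * y ≡ 1#
    enumeration : Carrier ↔ Fin q

module _ {q : ℕ} (F : FiniteField q) where
  open FiniteField F

  Mat : ℕ → ℕ → Set
  Mat ℓ m = Fin ℓ → Fin m → Carrier

  ∑ : {n : ℕ} → (Fin n → Carrier) → Carrier
  ∑ {zero} g = 0#
  ∑ {suc n} g = g fz + ∑ (λ i → g (fs i))

  -- a linear homogeneous polynomial f = Σ f_ij X_ij is given by its coefficient matrix;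
  -- evaluation f(M) = Σ f_ij M_ij
  LinForm : ℕ → ℕ → Set
  LinForm = Mat

  eval : {ℓ m : ℕ} → LinForm ℓ m → Mat ℓ m → Carrier
  eval f M = ∑ (λ i → ∑ (λ j → f i j * M i j))

  Rank1 : {ℓ m : ℕ} → Mat ℓ m → Set
  Rank1 {ℓ} {m} M =
    (Σ (Fin ℓ) λ i → Σ (Fin m) λ j → M i j ≢ 0#) ×
    (Σ (Fin ℓ → Carrier) λ u → Σ (Fin m → Carrier) λ v → ∀ i j → M i j ≡ u i * v j)

  ScalarMultiple : {ℓ m : ℕ} → Mat ℓ m → Mat ℓ m → Set
  ScalarMultiple M N = Σ Carrier λ c → c ≢ 0# × (∀ i j → M i j ≡ c * N i j)

  IsRank1Representatives : {ℓ m n̂ : ℕ} → (Fin n̂ → Mat ℓ m) → Set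
  IsRank1Representatives {ℓ} {m} {n̂} rep =
    (∀ k → Rank1 (rep k)) ×
    (∀ (M : Mat ℓ m) → Rank1 M → Σ (Fin n̂) λ k → ScalarMultiple M (rep k)) ×
    (∀ k k′ → ScalarMultiple (rep k) (rep k′) → k ≡ k′)

  codeword : {ℓ m n̂ : ℕ} → (Fin n̂ → Mat ℓ m) → LinForm ℓ m → Fin n̂ → Carrier
  codeword rep f k = eval f (rep k)

  wH : {n : ℕ} → (Fin n → Carrier) → ℕ
  wH {zero} c = 0
  wH {suc n} c with c fz ≟ 0#
  ... | yes _ = wH (λ i → c (fs i))
  ... | no _ = suc (wH (λ i → c (fs i)))

  τ : {ℓ m : ℕ} → ℕ → LinForm ℓ m
  τ r i j with toℕ i ℕ.≟ toℕ j ×-dec toℕ i ℕ.<? r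
  ... | yes _ = 1#
  ... | no _ = 0#

ŵ : (q ℓ m r : ℕ) → ℕ
ŵ q ℓ m zero = 0
ŵ q ℓ m (suc r) = ŵ q ℓ m r ℕ.+ q ^ (ℓ ℕ.+ m ∸ 2 ∸ r)

{-# OPTIONS --safe #-}

-- Count the pairs (u , v) ∈ F^ℓ × F^m with f (u vᵀ) ≠ 0 in two ways. Each rank-one matrix
-- is c M̂ₖ for exactly one k and one c ≠ 0, and equals u vᵀ for exactly q − 1 pairs, so the
-- count is (q − 1)² w_H(ĉ_f). On the other hand f (u vᵀ) = ⟨uᵀ f , v⟩, and a nonzero linear
-- form on F^m is nonzero at (q − 1) q^(m − 1) vectors, so the count is also
-- (q − 1) q^(m − 1) (q^ℓ − q^d), where q^d is the size of the left kernel {u ∣ uᵀ f = 0}.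
-- Hence w_H(ĉ_f) = ŵ_(ℓ − d). For τ_r the left kernel is {u ∣ u₁ = ⋯ = u_r = 0}, so d = ℓ − r;
-- everything else is arithmetic on the geometric sums ŵ_r.
module Submission where

open import Defs

open import Level using (0ℓ)
open import Algebra.Bundles using (Semiring; CommutativeRing)
open import Data.Empty using (⊥-elim)
open import Data.Nat as ℕ using (ℕ; zero; suc; _+_; _*_; _^_; _∸_; _≤_; _<_; z≤n; s≤s; >-nonZero)
open import Data.Nat.Tactic.RingSolver using (solve-∀)
open import Data.Nat.Properties
  using (+-*-semiring; +-comm; +-suc; *-comm; *-assoc; *-identityˡ; *-identityʳ; *-zeroʳ; *-distribˡ-+;
         *-distribˡ-∸; *-distribʳ-∸; ^-distribˡ-+-*; m^n>0; +-cancelʳ-≡; *-cancelˡ-≡; m+n≡0⇒m≡0; m+n≡0⇒n≡0;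
         1+n≢0; m+n∸n≡m; m∸n+n≡m; +-∸-assoc; ∸-+-assoc; m∸n≤m; m∸[m∸n]≡n; m∸n≢0⇒n<m; m<n⇒0<n∸m;
         ≤-refl; ≤-reflexive; ≤-trans; <-trans; <⇒≤; ≤-pred; m≤m+n; m≤n⇒m≤1+n; m<m+n; m≤n⇒m<n∨m≡n; n≢0⇒n>0)
open import Data.Fin using (Fin; zero; suc; toℕ; punchIn; inject≤)
open import Data.Fin.Properties using (punchInᵢ≢i; ¬∀⟶∃¬; all?; toℕ-inject≤; toℕ-injective)
open import Data.Fin.Permutation using (Permutation′)
open import Data.Product using (Σ; ∃; _×_; _,_; proj₁; proj₂)
open import Data.Sum using (inj₁; inj₂)
open import Data.Vec using (Vec; []; _∷_; lookup; zipWith; map; replicate; tabulate)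
import Data.Vec.Properties as Vec
open import Function using (_∘_; _↔_; Inverse; mk↔ₛ′)
open import Function.Construct.Composition using (_↔-∘_)
open import Function.Construct.Symmetry using (↔-sym)
open import Relation.Nullary using (¬_; Dec; yes; no; ¬?)
open import Relation.Unary using (Decidable)
open import Relation.Nullary.Decidable using (_×-dec_; _→-dec_)
open import Relation.Binary.Definitions using (DecidableEquality)
open import Relation.Binary.PropositionalEquality
  using (_≡_; _≢_; refl; sym; trans; cong; cong₂; subst; module ≡-Reasoning)

private variable
  P R : Set
  n : ℕ

𝟙 : Dec P → ℕ
𝟙 (yes _) = 1
𝟙 (no _) = 0

𝟙-yes : (d : Dec P) → P → 𝟙 d ≡ 1
𝟙-yes (yes _) _ = refl
𝟙-yes (no ¬p) p = ⊥-elim (¬p p)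

𝟙-no : (d : Dec P) → ¬ P → 𝟙 d ≡ 0
𝟙-no (yes p) ¬p = ⊥-elim (¬p p)
𝟙-no (no _) _ = refl

𝟙-cong : (d : Dec P) (e : Dec R) → (P → R) → (R → P) → 𝟙 d ≡ 𝟙 e
𝟙-cong (yes p) e to _ = sym (𝟙-yes e (to p))
𝟙-cong (no ¬p) e _ from = sym (𝟙-no e (¬p ∘ from))

𝟙-× : (d : Dec P) (e : Dec R) → 𝟙 (d ×-dec e) ≡ 𝟙 d * 𝟙 e
𝟙-× (yes _) (yes _) = refl
𝟙-× (yes _) (no _) = refl
𝟙-× (no _) _ = refl

𝟙-¬?+𝟙 : (d : Dec P) → 𝟙 (¬? d) + 𝟙 d ≡ 1
𝟙-¬?+𝟙 (yes _) = refl
𝟙-¬?+𝟙 (no _) = refl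

𝟙≢0⇒ : (d : Dec P) → 𝟙 d ≢ 0 → P
𝟙≢0⇒ (yes p) _ = p
𝟙≢0⇒ (no _) 𝟙≢0 = ⊥-elim (𝟙≢0 refl)

module SemiringSum (S : Semiring 0ℓ 0ℓ) where
  open Semiring S using (Carrier; _≈_; 0#; +-congˡ; +-identityʳ; setoid) renaming (_+_ to _⊕_)
  open import Algebra.Properties.Semiring.Sum S public
  open import Relation.Binary.Reasoning.Setoid setoid

  sum-zero : {g : Fin n → Carrier} → (∀ i → g i ≈ 0#) → sum g ≈ 0#
  sum-zero {n} {g} g≈0 = begin
    sum g                 ≈⟨ sum-cong-≋ {n} g≈0 ⟩
    sum {n} (λ _ → 0#)    ≈⟨ sum-replicate-zero n ⟩
    0#                    ∎

  sum-single : (g : Fin n → Carrier) (j : Fin n) → (∀ i → i ≢ j → g i ≈ 0#) → sum g ≈ g j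
  sum-single {suc n} g j others≈0 = begin
    sum g                         ≈⟨ sum-remove g ⟩
    g j ⊕ sum (g ∘ punchIn j)     ≈⟨ +-congˡ (sum-zero (λ i → others≈0 (punchIn j i) (punchInᵢ≢i j i))) ⟩
    g j ⊕ 0#                      ≈⟨ +-identityʳ (g j) ⟩
    g j                           ∎

open SemiringSum +-*-semiring using (sum; sum-permute; sum-zero; sum-single; *-distribˡ-sum; *-distribʳ-sum)
  renaming (sum-cong-≗ to sum-cong; ∑-distrib-+ to sum-+; ∑-comm to sum-comm)

sum-const : ∀ n c → sum {n} (λ _ → c) ≡ n * c
sum-const zero c = refl
sum-const (suc n) c = cong (c +_) (sum-const n c)

sum≡0⇒ : (g : Fin n → ℕ) → sum g ≡ 0 → ∀ i → g i ≡ 0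
sum≡0⇒ g ∑≡0 zero = m+n≡0⇒m≡0 (g zero) ∑≡0
sum≡0⇒ g ∑≡0 (suc i) = sum≡0⇒ (g ∘ suc) (m+n≡0⇒n≡0 (g zero) ∑≡0) i

sum≢0⇒ : (g : Fin n → ℕ) → sum g ≢ 0 → ∃ λ i → g i ≢ 0
sum≢0⇒ {n} g ∑≢0 = ¬∀⟶∃¬ n _ (λ i → g i ℕ.≟ 0) (∑≢0 ∘ sum-zero)

module FiniteSum {A : Set} {k : ℕ} (enum : A ↔ Fin k) where
  open Inverse enum using (to; from; strictlyInverseˡ; strictlyInverseʳ)

  sumOver : (A → ℕ) → ℕ
  sumOver h = sum (h ∘ from)

  sumOver-cong : {g h : A → ℕ} → (∀ x → g x ≡ h x) → sumOver g ≡ sumOver h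
  sumOver-cong g≗h = sum-cong (g≗h ∘ from)

  sumOver-+ : (g h : A → ℕ) → sumOver (λ x → g x + h x) ≡ sumOver g + sumOver h
  sumOver-+ g h = sum-+ (g ∘ from) (h ∘ from)

  sumOver-*ˡ : ∀ c (h : A → ℕ) → sumOver (λ x → c * h x) ≡ c * sumOver h
  sumOver-*ˡ c h = sym (*-distribˡ-sum c (h ∘ from))

  sumOver-*ʳ : ∀ c (h : A → ℕ) → sumOver (λ x → h x * c) ≡ sumOver h * c
  sumOver-*ʳ c h = sym (*-distribʳ-sum c (h ∘ from))

  sumOver-const : ∀ c → sumOver (λ _ → c) ≡ k * c
  sumOver-const = sum-const k

  sumOver-single : (h : A → ℕ) (a : A) → (∀ x → x ≢ a → h x ≡ 0) → sumOver h ≡ h a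
  sumOver-single h a others≡0 =
    trans (sum-single (h ∘ from) (to a) (λ i i≢ → others≡0 (from i) (i≢ ∘ from≡a⇒)))
          (cong h (strictlyInverseʳ a))
    where
    from≡a⇒ : ∀ {i} → from i ≡ a → i ≡ to a
    from≡a⇒ {i} refl = sym (strictlyInverseˡ i)

  sumOver-zero : {h : A → ℕ} → (∀ x → h x ≡ 0) → sumOver h ≡ 0
  sumOver-zero h≡0 = sum-zero (h≡0 ∘ from)

  sumOver≡0⇒ : (h : A → ℕ) → sumOver h ≡ 0 → ∀ x → h x ≡ 0
  sumOver≡0⇒ h ∑≡0 x = subst (λ y → h y ≡ 0) (strictlyInverseʳ x) (sum≡0⇒ (h ∘ from) ∑≡0 (to x))

  sumOver≢0⇒ : (h : A → ℕ) → sumOver h ≢ 0 → ∃ λ x → h x ≢ 0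
  sumOver≢0⇒ h ∑≢0 with sum≢0⇒ (h ∘ from) ∑≢0
  ... | i , hᵢ≢0 = from i , hᵢ≢0

  sumOver-complement : {P : A → Set} (P? : Decidable P) →
    sumOver (λ x → 𝟙 (¬? (P? x))) + sumOver (λ x → 𝟙 (P? x)) ≡ k
  sumOver-complement P? =
    trans (sym (sumOver-+ (λ x → 𝟙 (¬? (P? x))) (λ x → 𝟙 (P? x))))
          (trans (sumOver-cong (λ x → 𝟙-¬?+𝟙 (P? x))) (trans (sumOver-const 1) (*-identityʳ k)))

  sumOver-bijection : (π : A ↔ A) (h : A → ℕ) → sumOver (h ∘ Inverse.to π) ≡ sumOver h
  sumOver-bijection π h = sym (trans (sum-permute (h ∘ from) σ)
                                     (sum-cong (λ i → cong h (strictlyInverseʳ (Inverse.to π (from i))))))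
    where
    σ : Permutation′ k
    σ = enum ↔-∘ (π ↔-∘ ↔-sym enum)

  sum-sumOver-comm : ∀ {m} (g : Fin m → A → ℕ) →
    sum (λ i → sumOver (g i)) ≡ sumOver (λ x → sum (λ i → g i x))
  sum-sumOver-comm g = sum-comm (λ i j → g i (from j))

  sumVec : ∀ n → (Vec A n → ℕ) → ℕ
  sumVec zero h = h []
  sumVec (suc n) h = sumOver (λ x → sumVec n (λ y → h (x ∷ y)))

  sumVec-cong : ∀ n {g h : Vec A n → ℕ} → (∀ y → g y ≡ h y) → sumVec n g ≡ sumVec n h
  sumVec-cong zero g≗h = g≗h []
  sumVec-cong (suc n) g≗h = sumOver-cong (λ x → sumVec-cong n (λ y → g≗h (x ∷ y)))

  sumVec-+ : ∀ n (g h : Vec A n → ℕ) → sumVec n (λ y → g y + h y) ≡ sumVec n g + sumVec n h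
  sumVec-+ zero g h = refl
  sumVec-+ (suc n) g h =
    trans (sumOver-cong (λ x → sumVec-+ n (λ y → g (x ∷ y)) (λ y → h (x ∷ y))))
          (sumOver-+ (λ x → sumVec n (λ y → g (x ∷ y))) (λ x → sumVec n (λ y → h (x ∷ y))))

  sumVec-*ˡ : ∀ n c (h : Vec A n → ℕ) → sumVec n (λ y → c * h y) ≡ c * sumVec n h
  sumVec-*ˡ zero c h = refl
  sumVec-*ˡ (suc n) c h =
    trans (sumOver-cong (λ x → sumVec-*ˡ n c (λ y → h (x ∷ y))))
          (sumOver-*ˡ c (λ x → sumVec n (λ y → h (x ∷ y))))

  sumVec-const : ∀ n c → sumVec n (λ _ → c) ≡ k ^ n * c
  sumVec-const zero c = sym (*-identityˡ c)
  sumVec-const (suc n) c =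
    trans (sumOver-cong (λ _ → sumVec-const n c))
          (trans (sumOver-const (k ^ n * c)) (sym (*-assoc k (k ^ n) c)))

  sumVec-*ʳ : ∀ n c (h : Vec A n → ℕ) → sumVec n (λ y → h y * c) ≡ sumVec n h * c
  sumVec-*ʳ n c h = trans (sumVec-cong n (λ y → *-comm (h y) c)) (trans (sumVec-*ˡ n c h) (*-comm c (sumVec n h)))

  sumVec-× : ∀ ℓ m (g : Vec A ℓ → ℕ) (h : Vec A m → ℕ) →
    sumVec ℓ (λ u → sumVec m (λ v → g u * h v)) ≡ sumVec ℓ g * sumVec m h
  sumVec-× ℓ m g h = trans (sumVec-cong ℓ (λ u → sumVec-*ˡ m (g u) h)) (sumVec-*ʳ ℓ (sumVec m h) g)

  sumVec-zero : ∀ n {h : Vec A n → ℕ} → (∀ y → h y ≡ 0) → sumVec n h ≡ 0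
  sumVec-zero n h≡0 = trans (sumVec-cong n h≡0) (trans (sumVec-const n 0) (*-zeroʳ (k ^ n)))

  sumVec-complement : ∀ n {P : Vec A n → Set} (P? : Decidable P) →
    sumVec n (λ y → 𝟙 (¬? (P? y))) + sumVec n (λ y → 𝟙 (P? y)) ≡ k ^ n
  sumVec-complement n P? =
    trans (sym (sumVec-+ n (λ y → 𝟙 (¬? (P? y))) (λ y → 𝟙 (P? y))))
          (trans (sumVec-cong n (λ y → 𝟙-¬?+𝟙 (P? y))) (trans (sumVec-const n 1) (*-identityʳ (k ^ n))))

  sumVec-∷ : ∀ n (f : Vec A (suc n) → ℕ) (g : A → ℕ) (h : Vec A n → ℕ) →
    (∀ x y → f (x ∷ y) ≡ g x * h y) → sumVec (suc n) f ≡ sumOver g * sumVec n h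
  sumVec-∷ n f g h f≡g*h =
    trans (sumOver-cong (λ x → trans (sumVec-cong n (f≡g*h x)) (sumVec-*ˡ n (g x) h)))
          (sumOver-*ʳ (sumVec n h) g)

  sumVec≡0⇒ : ∀ n (h : Vec A n → ℕ) → sumVec n h ≡ 0 → ∀ y → h y ≡ 0
  sumVec≡0⇒ zero h ∑≡0 [] = ∑≡0
  sumVec≡0⇒ (suc n) h ∑≡0 (x ∷ y) =
    sumVec≡0⇒ n (λ z → h (x ∷ z)) (sumOver≡0⇒ (λ x → sumVec n (λ z → h (x ∷ z))) ∑≡0 x) y

  sumVec≢0⇒ : ∀ n (h : Vec A n → ℕ) → sumVec n h ≢ 0 → ∃ λ y → h y ≢ 0
  sumVec≢0⇒ zero h ∑≢0 = [] , ∑≢0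
  sumVec≢0⇒ (suc n) h ∑≢0 with sumOver≢0⇒ (λ x → sumVec n (λ y → h (x ∷ y))) ∑≢0
  ... | x , slice≢0 with sumVec≢0⇒ n (λ y → h (x ∷ y)) slice≢0
  ...   | y , hxy≢0 = x ∷ y , hxy≢0

  sum-sumVec-comm : ∀ {m} n (g : Fin m → Vec A n → ℕ) →
    sum (λ i → sumVec n (g i)) ≡ sumVec n (λ y → sum (λ i → g i y))
  sum-sumVec-comm zero g = refl
  sum-sumVec-comm (suc n) g =
    trans (sum-sumOver-comm (λ i x → sumVec n (λ y → g i (x ∷ y))))
          (sumOver-cong (λ x → sum-sumVec-comm n (λ i y → g i (x ∷ y))))

  sumOver-sumVec-comm : ∀ n (g : A → Vec A n → ℕ) →
    sumOver (λ x → sumVec n (g x)) ≡ sumVec n (λ y → sumOver (λ x → g x y))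
  sumOver-sumVec-comm n g = sum-sumVec-comm n (g ∘ from)

  sumVec²-sum-comm : ∀ {j} ℓ m (g : Fin j → Vec A ℓ → Vec A m → ℕ) →
    sumVec ℓ (λ u → sumVec m (λ v → sum (λ i → g i u v))) ≡ sum (λ i → sumVec ℓ (λ u → sumVec m (g i u)))
  sumVec²-sum-comm ℓ m g =
    trans (sumVec-cong ℓ (λ u → sym (sum-sumVec-comm m (λ i → g i u))))
          (sym (sum-sumVec-comm ℓ (λ i u → sumVec m (g i u))))

  sumVec²-sumOver-comm : ∀ ℓ m (g : A → Vec A ℓ → Vec A m → ℕ) →
    sumVec ℓ (λ u → sumVec m (λ v → sumOver (λ x → g x u v))) ≡ sumOver (λ x → sumVec ℓ (λ u → sumVec m (g x u)))
  sumVec²-sumOver-comm ℓ m g = sumVec²-sum-comm ℓ m (g ∘ from)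

  module _ (_≟ᴬ_ : DecidableEquality A) where

    sumOver-point : (a : A) → sumOver (λ x → 𝟙 (x ≟ᴬ a)) ≡ 1
    sumOver-point a = trans (sumOver-single _ a (λ x x≢a → 𝟙-no (x ≟ᴬ a) x≢a)) (𝟙-yes (a ≟ᴬ a) refl)

    sumVec-point : ∀ n (w : Vec A n) → sumVec n (λ y → 𝟙 (Vec.≡-dec _≟ᴬ_ y w)) ≡ 1
    sumVec-point zero [] = refl
    sumVec-point (suc n) (a ∷ w) = begin
      sumVec (suc n) (λ y → 𝟙 (Vec.≡-dec _≟ᴬ_ y (a ∷ w)))
        ≡⟨ sumVec-∷ n (λ y → 𝟙 (Vec.≡-dec _≟ᴬ_ y (a ∷ w))) (λ x → 𝟙 (x ≟ᴬ a)) (λ y → 𝟙 (Vec.≡-dec _≟ᴬ_ y w)) split ⟩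
      sumOver (λ x → 𝟙 (x ≟ᴬ a)) * sumVec n (λ y → 𝟙 (Vec.≡-dec _≟ᴬ_ y w))
        ≡⟨ cong₂ _*_ (sumOver-point a) (sumVec-point n w) ⟩
      1 ∎
      where
      open ≡-Reasoning
      split : ∀ x y → 𝟙 (Vec.≡-dec _≟ᴬ_ (x ∷ y) (a ∷ w)) ≡ 𝟙 (x ≟ᴬ a) * 𝟙 (Vec.≡-dec _≟ᴬ_ y w)
      split x y = trans (𝟙-cong (Vec.≡-dec _≟ᴬ_ (x ∷ y) (a ∷ w)) ((x ≟ᴬ a) ×-dec Vec.≡-dec _≟ᴬ_ y w)
                                Vec.∷-injective (λ { (refl , refl) → refl }))
                        (𝟙-× (x ≟ᴬ a) (Vec.≡-dec _≟ᴬ_ y w))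

ŵ-geometric : ∀ q ℓ m r → 1 ≤ q → r ≤ suc (ℓ + m ∸ 2) →
  ŵ q ℓ m r * (q ∸ 1) + q ^ (suc (ℓ + m ∸ 2) ∸ r) ≡ q ^ suc (ℓ + m ∸ 2)
ŵ-geometric q ℓ m zero _ _ = refl
ŵ-geometric (suc p) ℓ m (suc r) (s≤s z≤n) (s≤s r≤E) = begin
  (ŵ q ℓ m r + x) * p + x         ≡⟨ regroup (ŵ q ℓ m r) x p ⟩
  ŵ q ℓ m r * p + x * suc p       ≡⟨ cong (λ e → ŵ q ℓ m r * p + e) (*-comm x q) ⟩
  ŵ q ℓ m r * p + q ^ suc (E ∸ r) ≡⟨ cong (λ e → ŵ q ℓ m r * p + q ^ e) (+-∸-assoc 1 r≤E) ⟨
  ŵ q ℓ m r * p + q ^ (suc E ∸ r) ≡⟨ ŵ-geometric q ℓ m r (s≤s z≤n) (m≤n⇒m≤1+n r≤E) ⟩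
  q ^ suc E                       ∎
  where
  open ≡-Reasoning
  q E x : ℕ
  q = suc p
  E = ℓ + m ∸ 2
  x = q ^ (E ∸ r)
  regroup : ∀ w x p → (w + x) * p + x ≡ w * p + x * suc p
  regroup = solve-∀

ŵ-<-suc : ∀ q ℓ m r → 1 ≤ q → ŵ q ℓ m r < ŵ q ℓ m (suc r)
ŵ-<-suc q ℓ m r 1≤q = m<m+n (ŵ q ℓ m r) (m^n>0 q {{>-nonZero 1≤q}} (ℓ + m ∸ 2 ∸ r))

ŵ-strictMono : ∀ q ℓ m {r s} → 1 ≤ q → r < s → ŵ q ℓ m r < ŵ q ℓ m s
ŵ-strictMono q ℓ m {r} {suc s} 1≤q r<1+s with m≤n⇒m<n∨m≡n (≤-pred r<1+s)
... | inj₁ r<s = <-trans (ŵ-strictMono q ℓ m 1≤q r<s) (ŵ-<-suc q ℓ m s 1≤q)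
... | inj₂ refl = ŵ-<-suc q ℓ m r 1≤q

ŵ-mono-≤ : ∀ q ℓ m {r s} → 1 ≤ q → r ≤ s → ŵ q ℓ m r ≤ ŵ q ℓ m s
ŵ-mono-≤ q ℓ m 1≤q r≤s with m≤n⇒m<n∨m≡n r≤s
... | inj₁ r<s = <⇒≤ (ŵ-strictMono q ℓ m 1≤q r<s)
... | inj₂ refl = ≤-refl

ŵ-geometric-top : ∀ q ℓ m r → 1 ≤ q → r ≤ suc ℓ + m →
  ŵ q (suc ℓ) (suc m) r * (q ∸ 1) + q ^ (suc ℓ + m ∸ r) ≡ q ^ (suc ℓ + m)
ŵ-geometric-top q ℓ m r 1≤q =
  subst (λ n → r ≤ n → ŵ q (suc ℓ) (suc m) r * (q ∸ 1) + q ^ (n ∸ r) ≡ q ^ n)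
        (cong (λ n → suc (n ∸ 1)) (+-suc ℓ m))
        (ŵ-geometric q (suc ℓ) (suc m) r 1≤q)

ŵ-closed-form : ∀ q ℓ m r → 1 ≤ q → r ≤ suc ℓ →
  ŵ q (suc ℓ) (suc m) r * (q ∸ 1) ≡ q ^ (suc ℓ + suc m ∸ r ∸ 1) * (q ^ r ∸ 1)
ŵ-closed-form q ℓ m r 1≤q r≤ℓ = begin
  ŵ q (suc ℓ) (suc m) r * (q ∸ 1)                 ≡⟨ m+n∸n≡m _ (q ^ (top ∸ r)) ⟨
  ŵ q (suc ℓ) (suc m) r * (q ∸ 1) + q ^ (top ∸ r) ∸ q ^ (top ∸ r)
    ≡⟨ cong (_∸ q ^ (top ∸ r)) (ŵ-geometric-top q ℓ m r 1≤q r≤top) ⟩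
  q ^ top ∸ q ^ (top ∸ r)
    ≡⟨ cong₂ (λ e y → q ^ e ∸ y) (m∸n+n≡m r≤top) (*-identityʳ (q ^ (top ∸ r))) ⟨
  q ^ (top ∸ r + r) ∸ q ^ (top ∸ r) * 1           ≡⟨ cong (_∸ q ^ (top ∸ r) * 1) (^-distribˡ-+-* q (top ∸ r) r) ⟩
  q ^ (top ∸ r) * q ^ r ∸ q ^ (top ∸ r) * 1       ≡⟨ *-distribˡ-∸ (q ^ (top ∸ r)) (q ^ r) 1 ⟨
  q ^ (top ∸ r) * (q ^ r ∸ 1)                     ≡⟨ cong (λ e → q ^ e * (q ^ r ∸ 1)) exponent ⟩
  q ^ (suc ℓ + suc m ∸ r ∸ 1) * (q ^ r ∸ 1)       ∎
  where
  open ≡-Reasoning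
  top : ℕ
  top = suc ℓ + m
  r≤top : r ≤ top
  r≤top = ≤-trans r≤ℓ (m≤m+n (suc ℓ) m)
  exponent : top ∸ r ≡ suc ℓ + suc m ∸ r ∸ 1
  exponent = begin
    suc ℓ + m ∸ r             ≡⟨ cong (_∸ r) (+-suc ℓ m) ⟨
    ℓ + suc m ∸ r             ≡⟨ cong (suc ℓ + suc m ∸_) (+-comm r 1) ⟨
    suc ℓ + suc m ∸ (r + 1)   ≡⟨ ∸-+-assoc (suc ℓ + suc m) r 1 ⟨
    suc ℓ + suc m ∸ r ∸ 1     ∎

ŵ-from-counts : ∀ q ℓ m d {W N} → 1 < q → d ≤ suc ℓ →
  (q ∸ 1) * W ≡ q ^ m * N → N + q ^ d ≡ q ^ suc ℓ → W ≡ ŵ q (suc ℓ) (suc m) (suc ℓ ∸ d)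
ŵ-from-counts q ℓ m d {W} {N} 1<q d≤ℓ [q∸1]W≡q^mN N+q^d≡q^ℓ =
  *-cancelˡ-≡ W (ŵ q (suc ℓ) (suc m) r) (q ∸ 1) {{>-nonZero (m<n⇒0<n∸m 1<q)}}
    (+-cancelʳ-≡ (q ^ (m + d)) _ _ (trans counts (sym geometric)))
  where
  open ≡-Reasoning
  r : ℕ
  r = suc ℓ ∸ d
  exponent : suc ℓ + m ∸ r ≡ m + d
  exponent = trans (cong (_∸ r) (+-comm (suc ℓ) m)) (trans (+-∸-assoc m (m∸n≤m (suc ℓ) d)) (cong (m +_) (m∸[m∸n]≡n d≤ℓ)))
  geometric : (q ∸ 1) * ŵ q (suc ℓ) (suc m) r + q ^ (m + d) ≡ q ^ (m + suc ℓ)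
  geometric = begin
    (q ∸ 1) * ŵ q (suc ℓ) (suc m) r + q ^ (m + d)    ≡⟨ cong₂ (λ x e → x + q ^ e) (*-comm _ (q ∸ 1)) exponent ⟨
    ŵ q (suc ℓ) (suc m) r * (q ∸ 1) + q ^ (suc ℓ + m ∸ r)
      ≡⟨ ŵ-geometric-top q ℓ m r (<⇒≤ 1<q) (≤-trans (m∸n≤m (suc ℓ) d) (m≤m+n (suc ℓ) m)) ⟩
    q ^ (suc ℓ + m)                                  ≡⟨ cong (q ^_) (+-comm (suc ℓ) m) ⟩
    q ^ (m + suc ℓ)                                  ∎
  counts : (q ∸ 1) * W + q ^ (m + d) ≡ q ^ (m + suc ℓ)
  counts = begin
    (q ∸ 1) * W + q ^ (m + d)        ≡⟨ cong₂ _+_ [q∸1]W≡q^mN (^-distribˡ-+-* q m d) ⟩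
    q ^ m * N + q ^ m * q ^ d        ≡⟨ *-distribˡ-+ (q ^ m) N (q ^ d) ⟨
    q ^ m * (N + q ^ d)              ≡⟨ cong (q ^ m *_) N+q^d≡q^ℓ ⟩
    q ^ m * q ^ suc ℓ                ≡⟨ ^-distribˡ-+-* q m (suc ℓ) ⟨
    q ^ (m + suc ℓ)                  ∎

module FieldCounting {q : ℕ} (F : FiniteField q) where
  open FiniteField F renaming (_+_ to _⊕_; _*_ to _⊗_; -_ to ⊖_)
  open FiniteSum enumeration

  ring : CommutativeRing 0ℓ 0ℓ
  ring = record { isCommutativeRing = isCommutativeRing }

  module R = CommutativeRing ring
  open import Algebra.Properties.Group R.+-group using (//-rightDividesˡ; //-rightDividesʳ)
  open import Algebra.Properties.Ring R.ring using (-‿distribˡ-*)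
  open SemiringSum R.semiring using (sum-syntax)
    renaming (sum-cong-≗ to ∑-cong; sum-zero to ∑-zero; sum-single to ∑-single; ∑-distrib-+ to ∑-+;
              ∑-comm to ∑-comm; *-distribˡ-sum to ∑-*ˡ; *-distribʳ-sum to ∑-*ʳ)

  private variable
    x y z t : Carrier

  -- 0# ⁻¹ is the junk value 0#; every lemma about _⁻¹ assumes x ≢ 0#.
  _⁻¹ : Carrier → Carrier
  x ⁻¹ with x ≟ 0#
  ... | yes _ = 0#
  ... | no x≢0 = proj₁ (inverse x x≢0)

  ⁻¹-inverseʳ : x ≢ 0# → x ⊗ x ⁻¹ ≡ 1#
  ⁻¹-inverseʳ {x} x≢0 with x ≟ 0#
  ... | yes x≡0 = ⊥-elim (x≢0 x≡0)
  ... | no x≢0′ = proj₂ (inverse x x≢0′)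

  ⁻¹-inverseˡ : x ≢ 0# → x ⁻¹ ⊗ x ≡ 1#
  ⁻¹-inverseˡ {x} x≢0 = trans (R.*-comm (x ⁻¹) x) (⁻¹-inverseʳ x≢0)

  ⁻¹-solve : x ≢ 0# → x ⊗ y ≡ z → y ≡ x ⁻¹ ⊗ z
  ⁻¹-solve {x} {y} {z} x≢0 xy≡z = begin
    y                ≡⟨ R.*-identityˡ y ⟨
    1# ⊗ y           ≡⟨ cong (_⊗ y) (⁻¹-inverseˡ x≢0) ⟨
    x ⁻¹ ⊗ x ⊗ y     ≡⟨ R.*-assoc (x ⁻¹) x y ⟩
    x ⁻¹ ⊗ (x ⊗ y)   ≡⟨ cong (x ⁻¹ ⊗_) xy≡z ⟩
    x ⁻¹ ⊗ z         ∎
    where open ≡-Reasoning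

  ⊗-cancelˡ : x ≢ 0# → x ⊗ y ≡ x ⊗ z → y ≡ z
  ⊗-cancelˡ x≢0 xy≡xz = trans (⁻¹-solve x≢0 xy≡xz) (sym (⁻¹-solve x≢0 refl))

  ⊗-⁻¹-cancelˡ : x ≢ 0# → x ⊗ (x ⁻¹ ⊗ y) ≡ y
  ⊗-⁻¹-cancelˡ {x} {y} x≢0 =
    trans (sym (R.*-assoc x (x ⁻¹) y)) (trans (cong (_⊗ y) (⁻¹-inverseʳ x≢0)) (R.*-identityˡ y))

  ⊗-⁻¹-cancel-middle : ∀ a {t} b → t ≢ 0# → a ⊗ t ⊗ (t ⁻¹ ⊗ b) ≡ a ⊗ b
  ⊗-⁻¹-cancel-middle a {t} b t≢0 = trans (R.*-assoc a t (t ⁻¹ ⊗ b)) (cong (a ⊗_) (⊗-⁻¹-cancelˡ t≢0))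

  ⊗-cancelʳ : z ≢ 0# → x ⊗ z ≡ y ⊗ z → x ≡ y
  ⊗-cancelʳ {z} {x} {y} z≢0 xz≡yz = ⊗-cancelˡ z≢0 (trans (R.*-comm z x) (trans xz≡yz (R.*-comm y z)))

  ⊗-≢0 : x ≢ 0# → y ≢ 0# → x ⊗ y ≢ 0#
  ⊗-≢0 {x} {y} x≢0 y≢0 xy≡0 = y≢0 (⊗-cancelˡ x≢0 (trans xy≡0 (sym (R.zeroʳ x))))

  ⊗-≢0⇒ˡ : x ⊗ y ≢ 0# → x ≢ 0#
  ⊗-≢0⇒ˡ {x} {y} xy≢0 x≡0 = xy≢0 (trans (cong (_⊗ y) x≡0) (R.zeroˡ y))

  ⊗-≢0⇒ʳ : x ⊗ y ≢ 0# → y ≢ 0#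
  ⊗-≢0⇒ʳ {x} {y} xy≢0 y≡0 = xy≢0 (trans (cong (x ⊗_) y≡0) (R.zeroʳ x))

  ⁻¹-≢0 : x ≢ 0# → x ⁻¹ ≢ 0#
  ⁻¹-≢0 {x} x≢0 x⁻¹≡0 = 0≢1 (trans (sym (R.zeroʳ x)) (trans (cong (x ⊗_) (sym x⁻¹≡0)) (⁻¹-inverseʳ x≢0)))

  wt : Carrier → ℕ
  wt x = 𝟙 (¬? (x ≟ 0#))

  wt-≡0 : x ≡ 0# → wt x ≡ 0
  wt-≡0 {x} x≡0 = 𝟙-no (¬? (x ≟ 0#)) (λ x≢0 → x≢0 x≡0)

  wt-≢0 : x ≢ 0# → wt x ≡ 1
  wt-≢0 {x} = 𝟙-yes (¬? (x ≟ 0#))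

  wt-⊗ : ∀ x y → wt (x ⊗ y) ≡ wt x * wt y
  wt-⊗ x y with x ≟ 0# | y ≟ 0#
  ... | yes x≡0 | _       = wt-≡0 (trans (cong (_⊗ y) x≡0) (R.zeroˡ y))
  ... | no _    | yes y≡0 = wt-≡0 (trans (cong (x ⊗_) y≡0) (R.zeroʳ x))
  ... | no x≢0  | no y≢0  = wt-≢0 (⊗-≢0 x≢0 y≢0)

  wH≡sum-wt : ∀ {n} (c : Fin n → Carrier) → wH F c ≡ sum (wt ∘ c)
  wH≡sum-wt {zero} c = refl
  wH≡sum-wt {suc n} c with c zero ≟ 0#
  ... | yes _ = wH≡sum-wt (c ∘ suc)
  ... | no _ = cong suc (wH≡sum-wt (c ∘ suc))

  sumOver-wt : sumOver wt ≡ q ∸ 1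
  sumOver-wt = begin
    sumOver wt                                   ≡⟨ m+n∸n≡m (sumOver wt) 1 ⟨
    sumOver wt + 1 ∸ 1                           ≡⟨ cong (λ n → sumOver wt + n ∸ 1) (sumOver-point _≟_ 0#) ⟨
    sumOver wt + sumOver (λ x → 𝟙 (x ≟ 0#)) ∸ 1  ≡⟨ cong (_∸ 1) (sumOver-complement (_≟ 0#)) ⟩
    q ∸ 1                                        ∎
    where open ≡-Reasoning

  1<q : 1 < q
  1<q = m∸n≢0⇒n<m (λ q∸1≡0 → 1+n≢0 (trans (sym (wt-≢0 (0≢1 ∘ sym))) (sumOver≡0⇒ wt (trans sumOver-wt q∸1≡0) 1#)))

  sumOver-affine : ∀ {a} → a ≢ 0# → ∀ b c → sumOver (λ x → 𝟙 ((a ⊗ x ⊕ b) ≟ c)) ≡ 1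
  sumOver-affine {a} a≢0 b c =
    trans (sumOver-cong (λ x → 𝟙-cong ((a ⊗ x ⊕ b) ≟ c) (x ≟ root) solve unsolve)) (sumOver-point _≟_ root)
    where
    root : Carrier
    root = a ⁻¹ ⊗ (c ⊕ ⊖ b)
    solve : a ⊗ x ⊕ b ≡ c → x ≡ root
    solve {x} ax+b≡c = ⁻¹-solve a≢0 (trans (sym (//-rightDividesʳ b (a ⊗ x))) (cong (_⊕ ⊖ b) ax+b≡c))
    unsolve : x ≡ root → a ⊗ x ⊕ b ≡ c
    unsolve refl = trans (cong (_⊕ b) (⊗-⁻¹-cancelˡ a≢0)) (//-rightDividesˡ b c)

  translation : Carrier → Carrier ↔ Carrier
  translation t = mk↔ₛ′ (_⊕ t) (_⊕ ⊖ t) (//-rightDividesˡ t) (//-rightDividesʳ t)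

  infixl 6 _+ᵛ_
  _+ᵛ_ : ∀ {n} → Vec Carrier n → Vec Carrier n → Vec Carrier n
  _+ᵛ_ = zipWith _⊕_

  infixr 7 _·ᵛ_
  _·ᵛ_ : ∀ {n} → Carrier → Vec Carrier n → Vec Carrier n
  a ·ᵛ x = map (a ⊗_) x

  sumVec-translate : ∀ n (h : Vec Carrier n → ℕ) (t : Vec Carrier n) → sumVec n (λ y → h (y +ᵛ t)) ≡ sumVec n h
  sumVec-translate zero h [] = refl
  sumVec-translate (suc n) h (t₀ ∷ t) =
    trans (sumOver-cong (λ x → sumVec-translate n (λ y → h ((x ⊕ t₀) ∷ y)) t))
          (sumOver-bijection (translation t₀) (λ x → sumVec n (λ y → h (x ∷ y))))

  infix 7 _∙_
  _∙_ : ∀ {n} → (Fin n → Carrier) → Vec Carrier n → Carrier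
  _∙_ {n} w v = ∑[ j < n ] (w j ⊗ lookup v j)

  sumVec-∙≡-leading : ∀ {m} (w : Fin (suc m) → Carrier) → w zero ≢ 0# → ∀ c →
    sumVec (suc m) (λ v → 𝟙 ((w ∙ v) ≟ c)) ≡ q ^ m
  sumVec-∙≡-leading {m} w w₀≢0 c = begin
    sumOver (λ x → sumVec m (λ y → 𝟙 ((w zero ⊗ x ⊕ (w ∘ suc) ∙ y) ≟ c)))
      ≡⟨ sumOver-sumVec-comm m (λ x y → 𝟙 ((w zero ⊗ x ⊕ (w ∘ suc) ∙ y) ≟ c)) ⟩
    sumVec m (λ y → sumOver (λ x → 𝟙 ((w zero ⊗ x ⊕ (w ∘ suc) ∙ y) ≟ c)))
      ≡⟨ sumVec-cong m (λ y → sumOver-affine w₀≢0 ((w ∘ suc) ∙ y) c) ⟩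
    sumVec m (λ _ → 1)
      ≡⟨ trans (sumVec-const m 1) (*-identityʳ (q ^ m)) ⟩
    q ^ m ∎
    where open ≡-Reasoning

  sumVec-∙≡ : ∀ {m} (w : Fin (suc m) → Carrier) j → w j ≢ 0# → ∀ c →
    sumVec (suc m) (λ v → 𝟙 ((w ∙ v) ≟ c)) ≡ q ^ m
  sumVec-∙≡ w zero w₀≢0 c = sumVec-∙≡-leading w w₀≢0 c
  sumVec-∙≡ {suc m} w (suc j) wⱼ≢0 c with w zero ≟ 0#
  ... | no w₀≢0 = sumVec-∙≡-leading w w₀≢0 c
  ... | yes w₀≡0 = begin
    sumOver (λ x → sumVec (suc m) (λ y → 𝟙 ((w zero ⊗ x ⊕ (w ∘ suc) ∙ y) ≟ c)))
      ≡⟨ sumOver-cong (λ x → sumVec-cong (suc m) (λ y → cong (λ s → 𝟙 (s ≟ c)) (drop-leading x y))) ⟩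
    sumOver (λ _ → sumVec (suc m) (λ y → 𝟙 (((w ∘ suc) ∙ y) ≟ c)))
      ≡⟨ sumOver-cong (λ _ → sumVec-∙≡ (w ∘ suc) j wⱼ≢0 c) ⟩
    sumOver (λ _ → q ^ m)
      ≡⟨ sumOver-const (q ^ m) ⟩
    q * q ^ m ∎
    where
    open ≡-Reasoning
    drop-leading : ∀ x y → w zero ⊗ x ⊕ (w ∘ suc) ∙ y ≡ (w ∘ suc) ∙ y
    drop-leading x y = trans (cong (λ w₀ → w₀ ⊗ x ⊕ (w ∘ suc) ∙ y) w₀≡0)
                             (trans (cong (_⊕ (w ∘ suc) ∙ y) (R.zeroˡ x)) (R.+-identityˡ _))

  sumVec-wt-∙-nonzero : ∀ {m} (w : Fin (suc m) → Carrier) j → w j ≢ 0# →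
    sumVec (suc m) (λ v → wt (w ∙ v)) ≡ (q ∸ 1) * q ^ m
  sumVec-wt-∙-nonzero {m} w j wⱼ≢0 = begin
    S                       ≡⟨ m+n∸n≡m S (q ^ m) ⟨
    S + q ^ m ∸ q ^ m       ≡⟨ cong (λ n → S + n ∸ q ^ m) (sumVec-∙≡ w j wⱼ≢0 0#) ⟨
    S + Z ∸ q ^ m           ≡⟨ cong (_∸ q ^ m) (sumVec-complement (suc m) (λ v → (w ∙ v) ≟ 0#)) ⟩
    q * q ^ m ∸ q ^ m       ≡⟨ cong (q * q ^ m ∸_) (*-identityˡ (q ^ m)) ⟨
    q * q ^ m ∸ 1 * q ^ m   ≡⟨ *-distribʳ-∸ (q ^ m) q 1 ⟨
    (q ∸ 1) * q ^ m         ∎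
    where
    open ≡-Reasoning
    S Z : ℕ
    S = sumVec (suc m) (λ v → wt (w ∙ v))
    Z = sumVec (suc m) (λ v → 𝟙 ((w ∙ v) ≟ 0#))

  IsZeroVector : ∀ {n} → (Fin n → Carrier) → Set
  IsZeroVector w = ∀ j → w j ≡ 0#

  isZeroVector? : ∀ {n} (w : Fin n → Carrier) → Dec (IsZeroVector w)
  isZeroVector? w = all? (λ j → w j ≟ 0#)

  sumVec-wt-∙ : ∀ {m} (w : Fin (suc m) → Carrier) →
    sumVec (suc m) (λ v → wt (w ∙ v)) ≡ (q ∸ 1) * q ^ m * 𝟙 (¬? (isZeroVector? w))
  sumVec-wt-∙ {m} w with isZeroVector? w
  ... | yes w≡0 = trans (sumVec-zero (suc m) (λ v → wt-≡0 (∑-zero (λ j → w∙v≡0 v j)))) (sym (*-zeroʳ ((q ∸ 1) * q ^ m)))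
    where
    w∙v≡0 : ∀ v j → w j ⊗ lookup v j ≡ 0#
    w∙v≡0 v j = trans (cong (_⊗ lookup v j) (w≡0 j)) (R.zeroˡ (lookup v j))
  ... | no w≢0 with ¬∀⟶∃¬ (suc m) _ (λ j → w j ≟ 0#) w≢0
  ...   | j , wⱼ≢0 = trans (sumVec-wt-∙-nonzero w j wⱼ≢0) (sym (*-identityʳ ((q ∸ 1) * q ^ m)))

  +ᵛ-·ᵛ-cancel : ∀ {n} (y : Vec Carrier n) x z → y +ᵛ x ·ᵛ z +ᵛ ⊖ x ·ᵛ z ≡ y
  +ᵛ-·ᵛ-cancel [] x [] = refl
  +ᵛ-·ᵛ-cancel (a ∷ y) x (b ∷ z) = cong₂ _∷_ a+xb-xb≡a (+ᵛ-·ᵛ-cancel y x z)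
    where
    a+xb-xb≡a : a ⊕ x ⊗ b ⊕ ⊖ x ⊗ b ≡ a
    a+xb-xb≡a = trans (cong (a ⊕ x ⊗ b ⊕_) (sym (-‿distribˡ-* x b))) (//-rightDividesʳ (x ⊗ b) a)

  record IsSubspace {n} (P : Vec Carrier n → Set) : Set where
    field
      0∈ : P (replicate n 0#)
      +-closed : ∀ {x y} → P x → P y → P (x +ᵛ y)
      ·-closed : ∀ a {x} → P x → P (a ·ᵛ x)

  -- Either no vector of P starts with 1# and only the slice over 0# is inhabited,
  -- or every slice is a translate of the slice over 0#.
  module Slices {n} {P : Vec Carrier (suc n) → Set} (P? : Decidable P) (S : IsSubspace P) where
    open IsSubspace S

    slice : Carrier → ℕ
    slice x = sumVec n (λ y → 𝟙 (P? (x ∷ y)))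

    slice₀-subspace : IsSubspace (λ y → P (0# ∷ y))
    slice₀-subspace = record
      { 0∈ = 0∈
      ; +-closed = λ p₁ p₂ → subst (λ a → P (a ∷ _)) (R.+-identityˡ 0#) (+-closed p₁ p₂)
      ; ·-closed = λ a p → subst (λ b → P (b ∷ _)) (R.zeroʳ a) (·-closed a p)
      }

    slice-empty : slice 1# ≡ 0 → ∀ x → x ≢ 0# → slice x ≡ 0
    slice-empty slice₁≡0 x x≢0 = sumVec-zero n (λ y → 𝟙-no (P? (x ∷ y)) (λ pxy →
      1+n≢0 (trans (sym (𝟙-yes (P? (1# ∷ x ⁻¹ ·ᵛ y)) (normalise pxy)))
                   (sumVec≡0⇒ n (λ y → 𝟙 (P? (1# ∷ y))) slice₁≡0 (x ⁻¹ ·ᵛ y)))))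
      where
      normalise : ∀ {y} → P (x ∷ y) → P (1# ∷ x ⁻¹ ·ᵛ y)
      normalise {y} p = subst (λ a → P (a ∷ x ⁻¹ ·ᵛ y)) (⁻¹-inverseˡ x≢0) (·-closed (x ⁻¹) p)

    slice-translate : ∀ {y₁} → P (1# ∷ y₁) → ∀ x → slice x ≡ slice 0#
    slice-translate {y₁} p₁ x = begin
      slice x
        ≡⟨ sumVec-translate n (λ y → 𝟙 (P? (x ∷ y))) (x ·ᵛ y₁) ⟨
      sumVec n (λ y → 𝟙 (P? (x ∷ (y +ᵛ x ·ᵛ y₁))))
        ≡⟨ sumVec-cong n (λ y → 𝟙-cong (P? (x ∷ (y +ᵛ x ·ᵛ y₁))) (P? (0# ∷ y)) shift-out shift-in) ⟩
      slice 0# ∎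
      where
      open ≡-Reasoning
      shift-out : ∀ {y} → P (x ∷ (y +ᵛ x ·ᵛ y₁)) → P (0# ∷ y)
      shift-out p = subst P (cong₂ _∷_ x-x≡0 (+ᵛ-·ᵛ-cancel _ x y₁)) (+-closed p (·-closed (⊖ x) p₁))
        where
        x-x≡0 : x ⊕ ⊖ x ⊗ 1# ≡ 0#
        x-x≡0 = trans (cong (x ⊕_) (R.*-identityʳ (⊖ x))) (R.-‿inverseʳ x)
      shift-in : ∀ {y} → P (0# ∷ y) → P (x ∷ (y +ᵛ x ·ᵛ y₁))
      shift-in {y} p = subst (λ a → P (a ∷ (y +ᵛ x ·ᵛ y₁))) (trans (R.+-identityˡ (x ⊗ 1#)) (R.*-identityʳ x))
                             (+-closed p (·-closed x p₁))

  subspace-card : ∀ n {P : Vec Carrier n → Set} (P? : Decidable P) → IsSubspace P →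
    ∃ λ d → d ≤ n × sumVec n (λ y → 𝟙 (P? y)) ≡ q ^ d
  subspace-card zero P? S = 0 , z≤n , 𝟙-yes (P? []) (IsSubspace.0∈ S)
  subspace-card (suc n) P? S = extend (subspace-card n (λ y → P? (0# ∷ y)) slice₀-subspace)
    where
    open Slices P? S
    extend : (∃ λ d → d ≤ n × slice 0# ≡ q ^ d) → ∃ λ d → d ≤ suc n × sumOver slice ≡ q ^ d
    extend (d , d≤n , slice₀≡q^d) with slice 1# ℕ.≟ 0
    ... | yes slice₁≡0 = d , m≤n⇒m≤1+n d≤n ,
      trans (sumOver-single slice 0# (slice-empty slice₁≡0)) slice₀≡q^d
    ... | no slice₁≢0 with sumVec≢0⇒ n (λ y → 𝟙 (P? (1# ∷ y))) slice₁≢0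
    ...   | y₁ , p₁ = suc d , s≤s d≤n ,
      trans (sumOver-cong (λ x → trans (slice-translate (𝟙≢0⇒ (P? (1# ∷ y₁)) p₁) x) slice₀≡q^d))
            (sumOver-const (q ^ d))

  VanishesBelow : ∀ {n} → ℕ → Vec Carrier n → Set
  VanishesBelow r u = ∀ i → toℕ i < r → lookup u i ≡ 0#

  vanishesBelow? : ∀ {n} r (u : Vec Carrier n) → Dec (VanishesBelow r u)
  vanishesBelow? r u = all? (λ i → (toℕ i ℕ.<? r) →-dec (lookup u i ≟ 0#))

  sumVec-vanishesBelow : ∀ n r → r ≤ n → sumVec n (λ u → 𝟙 (vanishesBelow? r u)) ≡ q ^ (n ∸ r)
  sumVec-vanishesBelow n zero _ =
    trans (sumVec-cong n (λ u → 𝟙-yes (vanishesBelow? 0 u) (λ _ ()))) (trans (sumVec-const n 1) (*-identityʳ (q ^ n)))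
  sumVec-vanishesBelow (suc n) (suc r) (s≤s r≤n) = begin
    sumVec (suc n) (λ u → 𝟙 (vanishesBelow? (suc r) u))
      ≡⟨ sumVec-∷ n (λ u → 𝟙 (vanishesBelow? (suc r) u)) (λ x → 𝟙 (x ≟ 0#)) (λ y → 𝟙 (vanishesBelow? r y)) split ⟩
    sumOver (λ x → 𝟙 (x ≟ 0#)) * sumVec n (λ y → 𝟙 (vanishesBelow? r y))
      ≡⟨ cong₂ _*_ (sumOver-point _≟_ 0#) (sumVec-vanishesBelow n r r≤n) ⟩
    1 * q ^ (n ∸ r)
      ≡⟨ *-identityˡ (q ^ (n ∸ r)) ⟩
    q ^ (n ∸ r) ∎
    where
    open ≡-Reasoning
    head-tail : ∀ {x y} → VanishesBelow (suc r) (x ∷ y) → x ≡ 0# × VanishesBelow r y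
    head-tail v = v zero (s≤s z≤n) , λ i i<r → v (suc i) (s≤s i<r)
    cons : ∀ {x y} → x ≡ 0# × VanishesBelow r y → VanishesBelow (suc r) (x ∷ y)
    cons (x≡0 , _) zero _ = x≡0
    cons (_ , v) (suc i) (s≤s i<r) = v i i<r
    split : ∀ x y → 𝟙 (vanishesBelow? (suc r) (x ∷ y)) ≡ 𝟙 (x ≟ 0#) * 𝟙 (vanishesBelow? r y)
    split x y = trans (𝟙-cong (vanishesBelow? (suc r) (x ∷ y)) ((x ≟ 0#) ×-dec vanishesBelow? r y) head-tail cons)
                      (𝟙-× (x ≟ 0#) (vanishesBelow? r y))

  ∑≡sum : ∀ {n} (g : Fin n → Carrier) → ∑ F g ≡ ∑[ i < n ] g i
  ∑≡sum {zero} g = refl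
  ∑≡sum {suc n} g = cong (g zero ⊕_) (∑≡sum (g ∘ suc))

  eval≡∑∑ : ∀ {ℓ m} (f : LinForm F ℓ m) M → eval F f M ≡ ∑[ i < ℓ ] ∑[ j < m ] (f i j ⊗ M i j)
  eval≡∑∑ f M = trans (∑≡sum (λ i → ∑ F (λ j → f i j ⊗ M i j))) (∑-cong (λ i → ∑≡sum (λ j → f i j ⊗ M i j)))

  outer : ∀ {ℓ m} → Vec Carrier ℓ → Vec Carrier m → Mat F ℓ m
  outer u v i j = lookup u i ⊗ lookup v j

  infixl 7 _·ᴹ_
  _·ᴹ_ : ∀ {ℓ m} → Vec Carrier ℓ → Mat F ℓ m → Fin m → Carrier
  _·ᴹ_ {ℓ} u f j = ∑[ i < ℓ ] (lookup u i ⊗ f i j)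

  eval-outer : ∀ {ℓ m} (f : LinForm F ℓ m) u v → eval F f (outer u v) ≡ (u ·ᴹ f) ∙ v
  eval-outer {ℓ} {m} f u v = begin
    eval F f (outer u v)
      ≡⟨ eval≡∑∑ f (outer u v) ⟩
    ∑[ i < ℓ ] ∑[ j < m ] (f i j ⊗ (lookup u i ⊗ lookup v j))
      ≡⟨ ∑-cong (λ i → ∑-cong (λ j → reassoc (f i j) (lookup u i) (lookup v j))) ⟩
    ∑[ i < ℓ ] ∑[ j < m ] (lookup u i ⊗ f i j ⊗ lookup v j)
      ≡⟨ ∑-comm (λ i j → lookup u i ⊗ f i j ⊗ lookup v j) ⟩
    ∑[ j < m ] ∑[ i < ℓ ] (lookup u i ⊗ f i j ⊗ lookup v j)
      ≡⟨ ∑-cong (λ j → ∑-*ʳ (lookup v j) (λ i → lookup u i ⊗ f i j)) ⟨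
    (u ·ᴹ f) ∙ v ∎
    where
    open ≡-Reasoning
    reassoc : ∀ a b c → a ⊗ (b ⊗ c) ≡ b ⊗ a ⊗ c
    reassoc a b c = trans (sym (R.*-assoc a b c)) (cong (_⊗ c) (R.*-comm a b))

  LeftKernel : ∀ {ℓ m} → LinForm F ℓ m → Vec Carrier ℓ → Set
  LeftKernel f u = IsZeroVector (u ·ᴹ f)

  leftKernel? : ∀ {ℓ m} (f : LinForm F ℓ m) → Decidable (LeftKernel f)
  leftKernel? f u = isZeroVector? (u ·ᴹ f)

  leftKernel-subspace : ∀ {ℓ m} (f : LinForm F ℓ m) → IsSubspace (LeftKernel f)
  leftKernel-subspace {ℓ} f = record
    { 0∈ = 0∈ ; +-closed = λ {x} {y} → +-closed {x} {y} ; ·-closed = λ a {x} → ·-closed a {x} }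
    where
    0∈ : LeftKernel f (replicate ℓ 0#)
    0∈ j = ∑-zero (λ i → trans (cong (_⊗ f i j) (Vec.lookup-replicate i 0#)) (R.zeroˡ (f i j)))
    +-closed : ∀ {x y} → LeftKernel f x → LeftKernel f y → LeftKernel f (x +ᵛ y)
    +-closed {x} {y} x∈ y∈ j = begin
      ((x +ᵛ y) ·ᴹ f) j
        ≡⟨ ∑-cong (λ i → trans (cong (_⊗ f i j) (Vec.lookup-zipWith _⊕_ i x y))
                               (R.distribʳ (f i j) (lookup x i) (lookup y i))) ⟩
      ∑[ i < ℓ ] (lookup x i ⊗ f i j ⊕ lookup y i ⊗ f i j)
        ≡⟨ ∑-+ (λ i → lookup x i ⊗ f i j) (λ i → lookup y i ⊗ f i j) ⟩
      (x ·ᴹ f) j ⊕ (y ·ᴹ f) j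
        ≡⟨ cong₂ _⊕_ (x∈ j) (y∈ j) ⟩
      0# ⊕ 0#
        ≡⟨ R.+-identityˡ 0# ⟩
      0# ∎
      where open ≡-Reasoning
    ·-closed : ∀ a {x} → LeftKernel f x → LeftKernel f (a ·ᵛ x)
    ·-closed a {x} x∈ j = begin
      ((a ·ᵛ x) ·ᴹ f) j
        ≡⟨ ∑-cong (λ i → trans (cong (_⊗ f i j) (Vec.lookup-map i (a ⊗_) x)) (R.*-assoc a (lookup x i) (f i j))) ⟩
      ∑[ i < ℓ ] (a ⊗ (lookup x i ⊗ f i j))
        ≡⟨ ∑-*ˡ a (λ i → lookup x i ⊗ f i j) ⟨
      a ⊗ (x ·ᴹ f) j
        ≡⟨ cong (a ⊗_) (x∈ j) ⟩
      a ⊗ 0#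
        ≡⟨ R.zeroʳ a ⟩
      0# ∎
      where open ≡-Reasoning

  pairCount : ∀ {ℓ m} → LinForm F ℓ m → ℕ
  pairCount {ℓ} {m} f = sumVec ℓ (λ u → sumVec m (λ v → wt (eval F f (outer u v))))

  pairCount-via-leftKernel : ∀ {ℓ m} (f : LinForm F ℓ (suc m)) →
    pairCount f ≡ (q ∸ 1) * q ^ m * sumVec ℓ (λ u → 𝟙 (¬? (leftKernel? f u)))
  pairCount-via-leftKernel {ℓ} {m} f =
    trans (sumVec-cong ℓ (λ u → trans (sumVec-cong (suc m) (λ v → cong wt (eval-outer f u v))) (sumVec-wt-∙ (u ·ᴹ f))))
          (sumVec-*ˡ ℓ ((q ∸ 1) * q ^ m) (λ u → 𝟙 (¬? (leftKernel? f u))))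

  τ-diagonal : ∀ {ℓ m} r (i : Fin ℓ) (j : Fin m) → toℕ i ≡ toℕ j → toℕ i < r → τ F r i j ≡ 1#
  τ-diagonal r i j i≡j i<r with toℕ i ℕ.≟ toℕ j ×-dec toℕ i ℕ.<? r
  ... | yes _ = refl
  ... | no ¬diagonal = ⊥-elim (¬diagonal (i≡j , i<r))

  τ-off-diagonal : ∀ {ℓ m} r (i : Fin ℓ) (j : Fin m) → ¬ (toℕ i ≡ toℕ j × toℕ i < r) → τ F r i j ≡ 0#
  τ-off-diagonal r i j ¬diagonal with toℕ i ℕ.≟ toℕ j ×-dec toℕ i ℕ.<? r
  ... | yes diagonal = ⊥-elim (¬diagonal diagonal)
  ... | no _ = refl

  vanishesBelow⇒leftKernel-τ : ∀ {ℓ m} r {u : Vec Carrier ℓ} → VanishesBelow r u → LeftKernel {ℓ} {m} (τ F r) u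
  vanishesBelow⇒leftKernel-τ r {u} u<r≡0 j = ∑-zero term≡0
    where
    term≡0 : ∀ i → lookup u i ⊗ τ F r i j ≡ 0#
    term≡0 i with toℕ i ℕ.≟ toℕ j ×-dec toℕ i ℕ.<? r
    ... | yes (_ , i<r) = trans (cong (_⊗ 1#) (u<r≡0 i i<r)) (R.zeroˡ 1#)
    ... | no _ = R.zeroʳ (lookup u i)

  leftKernel-τ⇒vanishesBelow : ∀ {ℓ m} → ℓ ≤ m → ∀ r {u : Vec Carrier ℓ} → LeftKernel {ℓ} {m} (τ F r) u → VanishesBelow r u
  leftKernel-τ⇒vanishesBelow ℓ≤m r {u} u∈ i i<r = begin
    lookup u i               ≡⟨ R.*-identityʳ (lookup u i) ⟨
    lookup u i ⊗ 1#          ≡⟨ cong (lookup u i ⊗_) (τ-diagonal r i j i≡j i<r) ⟨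
    lookup u i ⊗ τ F r i j   ≡⟨ ∑-single (λ i′ → lookup u i′ ⊗ τ F r i′ j) i off-diagonal≡0 ⟨
    (u ·ᴹ τ F r) j           ≡⟨ u∈ j ⟩
    0#                       ∎
    where
    open ≡-Reasoning
    j = inject≤ i ℓ≤m
    i≡j : toℕ i ≡ toℕ j
    i≡j = sym (toℕ-inject≤ i ℓ≤m)
    off-diagonal≡0 : ∀ i′ → i′ ≢ i → lookup u i′ ⊗ τ F r i′ j ≡ 0#
    off-diagonal≡0 i′ i′≢i =
      trans (cong (lookup u i′ ⊗_) (τ-off-diagonal r i′ j (λ (i′≡j , _) → i′≢i (toℕ-injective (trans i′≡j (sym i≡j))))))
                                   (R.zeroʳ (lookup u i′))

  sumVec-leftKernel-τ : ∀ {ℓ m} → ℓ ≤ m → ∀ r → r ≤ ℓ → sumVec ℓ (λ u → 𝟙 (leftKernel? {ℓ} {m} (τ F r) u)) ≡ q ^ (ℓ ∸ r)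
  sumVec-leftKernel-τ {ℓ} ℓ≤m r r≤ℓ =
    trans (sumVec-cong ℓ (λ u → 𝟙-cong (leftKernel? (τ F r) u) (vanishesBelow? r u)
                                       (leftKernel-τ⇒vanishesBelow ℓ≤m r {u}) (vanishesBelow⇒leftKernel-τ r {u})))
          (sumVec-vanishesBelow ℓ r r≤ℓ)

  infix 4 _≐_ _≐?_
  _≐_ : ∀ {ℓ m} → Mat F ℓ m → Mat F ℓ m → Set
  M ≐ N = ∀ i j → M i j ≡ N i j

  _≐?_ : ∀ {ℓ m} (M N : Mat F ℓ m) → Dec (M ≐ N)
  M ≐? N = all? (λ i → all? (λ j → M i j ≟ N i j))

  scale : ∀ {ℓ m} → Carrier → Mat F ℓ m → Mat F ℓ m
  scale c M i j = c ⊗ M i j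

  eval-cong : ∀ {ℓ m} (f : LinForm F ℓ m) {M N} → M ≐ N → eval F f M ≡ eval F f N
  eval-cong f {M} {N} M≐N =
    trans (eval≡∑∑ f M) (trans (∑-cong (λ i → ∑-cong (λ j → cong (f i j ⊗_) (M≐N i j)))) (sym (eval≡∑∑ f N)))

  eval-scale : ∀ {ℓ m} (f : LinForm F ℓ m) c M → eval F f (scale c M) ≡ c ⊗ eval F f M
  eval-scale {ℓ} {m} f c M = begin
    eval F f (scale c M)                        ≡⟨ eval≡∑∑ f (scale c M) ⟩
    ∑[ i < ℓ ] ∑[ j < m ] (f i j ⊗ (c ⊗ M i j)) ≡⟨ ∑-cong (λ i → ∑-cong (λ j → swap (f i j) c (M i j))) ⟩
    ∑[ i < ℓ ] ∑[ j < m ] (c ⊗ (f i j ⊗ M i j)) ≡⟨ ∑-cong (λ i → ∑-*ˡ c (λ j → f i j ⊗ M i j)) ⟨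
    ∑[ i < ℓ ] (c ⊗ ∑[ j < m ] (f i j ⊗ M i j)) ≡⟨ ∑-*ˡ c (λ i → ∑[ j < m ] (f i j ⊗ M i j)) ⟨
    c ⊗ ∑[ i < ℓ ] ∑[ j < m ] (f i j ⊗ M i j)   ≡⟨ cong (c ⊗_) (eval≡∑∑ f M) ⟨
    c ⊗ eval F f M                              ∎
    where
    open ≡-Reasoning
    swap : ∀ a b c → a ⊗ (b ⊗ c) ≡ b ⊗ (a ⊗ c)
    swap a b c = trans (sym (R.*-assoc a b c)) (trans (cong (_⊗ c) (R.*-comm a b)) (R.*-assoc b a c))

  eval-zero : ∀ {ℓ m} (f : LinForm F ℓ m) {M} → (∀ i j → M i j ≡ 0#) → eval F f M ≡ 0#
  eval-zero f {M} M≡0 =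
    trans (eval≡∑∑ f M) (∑-zero (λ i → ∑-zero (λ j → trans (cong (f i j ⊗_) (M≡0 i j)) (R.zeroʳ (f i j)))))

  eval≢0⇒entry≢0 : ∀ {ℓ m} (f : LinForm F ℓ m) M → eval F f M ≢ 0# → ∃ λ i → ∃ λ j → M i j ≢ 0#
  eval≢0⇒entry≢0 {ℓ} {m} f M fM≢0 with ¬∀⟶∃¬ ℓ _ (λ i → isZeroVector? (M i)) (fM≢0 ∘ eval-zero f)
  ... | i , Mᵢ≢0 with ¬∀⟶∃¬ m _ (λ j → M i j ≟ 0#) Mᵢ≢0
  ...   | j , Mᵢⱼ≢0 = i , j , Mᵢⱼ≢0

  rank1-outer : ∀ {ℓ m} (f : LinForm F ℓ m) u v → eval F f (outer u v) ≢ 0# → Rank1 F (outer u v)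
  rank1-outer f u v fM≢0 = eval≢0⇒entry≢0 f (outer u v) fM≢0 , lookup u , lookup v , λ i j → refl

  rank1-scale : ∀ {ℓ m} {c} {M : Mat F ℓ m} → c ≢ 0# → Rank1 F M → Rank1 F (scale c M)
  rank1-scale {c = c} c≢0 ((i , j , Mᵢⱼ≢0) , a , b , M≐ab) =
    (i , j , ⊗-≢0 c≢0 Mᵢⱼ≢0) , (λ i → c ⊗ a i) , b , λ i j → trans (cong (c ⊗_) (M≐ab i j)) (sym (R.*-assoc c (a i) (b j)))

  -- The pairs (u , v) with u vᵀ = a bᵀ ≠ 0 are exactly (a t , t⁻¹ b) with t ≠ 0.
  module OuterFibre {ℓ m} (a : Fin ℓ → Carrier) (b : Fin m → Carrier) (N : Mat F ℓ m)
                    (N≐ab : ∀ i j → N i j ≡ a i ⊗ b j) {i₀ j₀} (a₀b₀≢0 : a i₀ ⊗ b j₀ ≢ 0#) where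

    A : Carrier → Vec Carrier ℓ
    A t = tabulate (λ i → a i ⊗ t)

    B : Carrier → Vec Carrier m
    B t = tabulate (λ j → t ⁻¹ ⊗ b j)

    Factorisation : Carrier → Vec Carrier ℓ → Vec Carrier m → Set
    Factorisation t u v = t ≢ 0# × u ≡ A t × v ≡ B t

    factorisation? : ∀ t u v → Dec (Factorisation t u v)
    factorisation? t u v = ¬? (t ≟ 0#) ×-dec Vec.≡-dec _≟_ u (A t) ×-dec Vec.≡-dec _≟_ v (B t)

    factorisation⇒outer≐ : ∀ {t u v} → Factorisation t u v → outer u v ≐ N
    factorisation⇒outer≐ {t} (t≢0 , refl , refl) i j = begin
      lookup (A t) i ⊗ lookup (B t) j ≡⟨ cong₂ _⊗_ (Vec.lookup∘tabulate _ i) (Vec.lookup∘tabulate _ j) ⟩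
      a i ⊗ t ⊗ (t ⁻¹ ⊗ b j)          ≡⟨ ⊗-⁻¹-cancel-middle (a i) (b j) t≢0 ⟩
      a i ⊗ b j                       ≡⟨ N≐ab i j ⟨
      N i j                           ∎
      where open ≡-Reasoning

    module Solution (u : Vec Carrier ℓ) (v : Vec Carrier m) (uv≐N : outer u v ≐ N) where
      uv≐ab : ∀ i j → lookup u i ⊗ lookup v j ≡ a i ⊗ b j
      uv≐ab i j = trans (uv≐N i j) (N≐ab i j)

      a₀≢0 : a i₀ ≢ 0#
      a₀≢0 = ⊗-≢0⇒ˡ a₀b₀≢0

      v₀≢0 : lookup v j₀ ≢ 0#
      v₀≢0 = ⊗-≢0⇒ʳ (a₀b₀≢0 ∘ trans (sym (uv≐ab i₀ j₀)))

      t₀ : Carrier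
      t₀ = b j₀ ⊗ lookup v j₀ ⁻¹

      t₀≢0 : t₀ ≢ 0#
      t₀≢0 = ⊗-≢0 (⊗-≢0⇒ʳ a₀b₀≢0) (⁻¹-≢0 v₀≢0)

      u≡at₀ : ∀ i → lookup u i ≡ a i ⊗ t₀
      u≡at₀ i = begin
        lookup u i                                  ≡⟨ R.*-identityʳ (lookup u i) ⟨
        lookup u i ⊗ 1#                             ≡⟨ cong (lookup u i ⊗_) (⁻¹-inverseʳ v₀≢0) ⟨
        lookup u i ⊗ (lookup v j₀ ⊗ lookup v j₀ ⁻¹) ≡⟨ R.*-assoc (lookup u i) (lookup v j₀) (lookup v j₀ ⁻¹) ⟨
        lookup u i ⊗ lookup v j₀ ⊗ lookup v j₀ ⁻¹   ≡⟨ cong (_⊗ lookup v j₀ ⁻¹) (uv≐ab i j₀) ⟩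
        a i ⊗ b j₀ ⊗ lookup v j₀ ⁻¹                 ≡⟨ R.*-assoc (a i) (b j₀) (lookup v j₀ ⁻¹) ⟩
        a i ⊗ t₀                                    ∎
        where open ≡-Reasoning

      v≡t₀⁻¹b : ∀ j → lookup v j ≡ t₀ ⁻¹ ⊗ b j
      v≡t₀⁻¹b j = ⁻¹-solve t₀≢0 (⊗-cancelˡ a₀≢0 (begin
        a i₀ ⊗ (t₀ ⊗ lookup v j)   ≡⟨ R.*-assoc (a i₀) t₀ (lookup v j) ⟨
        a i₀ ⊗ t₀ ⊗ lookup v j     ≡⟨ cong (_⊗ lookup v j) (u≡at₀ i₀) ⟨
        lookup u i₀ ⊗ lookup v j   ≡⟨ uv≐ab i₀ j ⟩
        a i₀ ⊗ b j                 ∎))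
        where open ≡-Reasoning

      factorisation-t₀ : Factorisation t₀ u v
      factorisation-t₀ = t₀≢0 , ≡tabulate u≡at₀ , ≡tabulate v≡t₀⁻¹b
        where
        ≡tabulate : ∀ {n} {w : Vec Carrier n} {g} → (∀ i → lookup w i ≡ g i) → w ≡ tabulate g
        ≡tabulate {w = w} w≗g = trans (sym (Vec.tabulate∘lookup w)) (Vec.tabulate-cong w≗g)

      factorisation-unique : ∀ {t} → Factorisation t u v → t ≡ t₀
      factorisation-unique {t} (_ , refl , _) =
        ⊗-cancelˡ a₀≢0 (trans (sym (Vec.lookup∘tabulate (λ i → a i ⊗ t) i₀)) (u≡at₀ i₀))

    𝟙-outer≐ : ∀ u v → 𝟙 (outer u v ≐? N) ≡ sumOver (λ t → 𝟙 (factorisation? t u v))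
    𝟙-outer≐ u v with outer u v ≐? N
    ... | no uv≉N = sym (sumOver-zero (λ t → 𝟙-no (factorisation? t u v) (uv≉N ∘ factorisation⇒outer≐)))
    ... | yes uv≐N = sym (trans (sumOver-single _ t₀ others≡0) (𝟙-yes (factorisation? t₀ u v) factorisation-t₀))
      where
      open Solution u v uv≐N
      others≡0 : ∀ t → t ≢ t₀ → 𝟙 (factorisation? t u v) ≡ 0
      others≡0 t t≢t₀ = 𝟙-no (factorisation? t u v) (t≢t₀ ∘ factorisation-unique)

    sumVec²-factorisation : ∀ t → sumVec ℓ (λ u → sumVec m (λ v → 𝟙 (factorisation? t u v))) ≡ wt t
    sumVec²-factorisation t = begin
      sumVec ℓ (λ u → sumVec m (λ v → 𝟙 (factorisation? t u v)))
        ≡⟨ sumVec-cong ℓ (λ u → sumVec-cong m (λ v → split u v)) ⟩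
      sumVec ℓ (λ u → sumVec m (λ v → wt t * (𝟙 (u ≟ᵛ A t) * 𝟙 (v ≟ᵛ B t))))
        ≡⟨ sumVec-cong ℓ (λ u → sumVec-*ˡ m (wt t) _) ⟩
      sumVec ℓ (λ u → wt t * sumVec m (λ v → 𝟙 (u ≟ᵛ A t) * 𝟙 (v ≟ᵛ B t)))
        ≡⟨ sumVec-*ˡ ℓ (wt t) _ ⟩
      wt t * sumVec ℓ (λ u → sumVec m (λ v → 𝟙 (u ≟ᵛ A t) * 𝟙 (v ≟ᵛ B t)))
        ≡⟨ cong (wt t *_) (sumVec-× ℓ m (λ u → 𝟙 (u ≟ᵛ A t)) (λ v → 𝟙 (v ≟ᵛ B t))) ⟩
      wt t * (sumVec ℓ (λ u → 𝟙 (u ≟ᵛ A t)) * sumVec m (λ v → 𝟙 (v ≟ᵛ B t)))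
        ≡⟨ cong (wt t *_) (cong₂ _*_ (sumVec-point _≟_ ℓ (A t)) (sumVec-point _≟_ m (B t))) ⟩
      wt t * 1
        ≡⟨ *-identityʳ (wt t) ⟩
      wt t ∎
      where
      open ≡-Reasoning
      _≟ᵛ_ : ∀ {n} → DecidableEquality (Vec Carrier n)
      _≟ᵛ_ = Vec.≡-dec _≟_
      split : ∀ u v → 𝟙 (factorisation? t u v) ≡ wt t * (𝟙 (u ≟ᵛ A t) * 𝟙 (v ≟ᵛ B t))
      split u v = trans (𝟙-× (¬? (t ≟ 0#)) _) (cong (wt t *_) (𝟙-× (u ≟ᵛ A t) (v ≟ᵛ B t)))

    sumVec²-outer≐ : sumVec ℓ (λ u → sumVec m (λ v → 𝟙 (outer u v ≐? N))) ≡ q ∸ 1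
    sumVec²-outer≐ = begin
      sumVec ℓ (λ u → sumVec m (λ v → 𝟙 (outer u v ≐? N)))
        ≡⟨ sumVec-cong ℓ (λ u → sumVec-cong m (𝟙-outer≐ u)) ⟩
      sumVec ℓ (λ u → sumVec m (λ v → sumOver (λ t → 𝟙 (factorisation? t u v))))
        ≡⟨ sumVec²-sumOver-comm ℓ m (λ t u v → 𝟙 (factorisation? t u v)) ⟩
      sumOver (λ t → sumVec ℓ (λ u → sumVec m (λ v → 𝟙 (factorisation? t u v))))
        ≡⟨ sumOver-cong sumVec²-factorisation ⟩
      sumOver wt
        ≡⟨ sumOver-wt ⟩
      q ∸ 1 ∎
      where open ≡-Reasoning

  sumVec²-outer≐-rank1 : ∀ {ℓ m} {N : Mat F ℓ m} → Rank1 F N →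
    sumVec ℓ (λ u → sumVec m (λ v → 𝟙 (outer u v ≐? N))) ≡ q ∸ 1
  sumVec²-outer≐-rank1 {N = N} ((i₀ , j₀ , N₀≢0) , a , b , N≐ab) =
    OuterFibre.sumVec²-outer≐ a b N N≐ab (N₀≢0 ∘ trans (N≐ab i₀ j₀))

  wt-*-cong : ∀ x {m n} → (x ≢ 0# → m ≡ n) → wt x * m ≡ wt x * n
  wt-*-cong x {m} {n} m≡n with x ≟ 0#
  ... | yes _ = refl
  ... | no x≢0 = cong (1 *_) (m≡n x≢0)

  wt-eval-scale : ∀ {ℓ m} (f : LinForm F ℓ m) c (M N : Mat F ℓ m) →
    wt c * wt (eval F f N) * 𝟙 (M ≐? scale c N) ≡ wt (eval F f M) * 𝟙 (M ≐? scale c N)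
  wt-eval-scale f c M N with M ≐? scale c N
  ... | no _ = trans (*-zeroʳ (wt c * wt (eval F f N))) (sym (*-zeroʳ (wt (eval F f M))))
  ... | yes M≐cN = cong (_* 1) (trans (sym (wt-⊗ c (eval F f N)))
                                      (cong wt (trans (sym (eval-scale f c N)) (sym (eval-cong f M≐cN)))))

  scalar-transfer : ∀ {ℓ m} {M N N′ : Mat F ℓ m} {c c′} → c ≢ 0# → c′ ≢ 0# →
    M ≐ scale c N → M ≐ scale c′ N′ → ScalarMultiple F N N′
  scalar-transfer {N′ = N′} {c} {c′} c≢0 c′≢0 M≐cN M≐c′N′ =
    c ⁻¹ ⊗ c′ , ⊗-≢0 (⁻¹-≢0 c≢0) c′≢0 ,
    λ i j → trans (⁻¹-solve c≢0 (sym (M≐cN i j))) (trans (cong (c ⁻¹ ⊗_) (M≐c′N′ i j)) (sym (R.*-assoc (c ⁻¹) c′ (N′ i j))))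

  module Representatives {ℓ m n̂} (rep : Fin n̂ → Mat F ℓ m) (isRep : IsRank1Representatives F rep) where

    rep-rank1 : ∀ k → Rank1 F (rep k)
    rep-rank1 = proj₁ isRep

    rep-cover : ∀ M → Rank1 F M → ∃ λ k → ScalarMultiple F M (rep k)
    rep-cover = proj₁ (proj₂ isRep)

    rep-distinct : ∀ k k′ → ScalarMultiple F (rep k) (rep k′) → k ≡ k′
    rep-distinct = proj₂ (proj₂ isRep)

    scalar-representation-unique : ∀ {M} → Rank1 F M → sum (λ k → sumOver (λ c → 𝟙 (M ≐? scale c (rep k)))) ≡ 1
    scalar-representation-unique {M} M-rank1@((i₁ , j₁ , M₁≢0) , _) with rep-cover M M-rank1
    ... | k₀ , c₀ , c₀≢0 , M≐c₀r =
      trans (sum-single _ k₀ other-k≡0) (trans (sumOver-single _ c₀ other-c≡0) (𝟙-yes (M ≐? scale c₀ (rep k₀)) M≐c₀r))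
      where
      scalar≢0 : ∀ {c k} → M ≐ scale c (rep k) → c ≢ 0#
      scalar≢0 {c} {k} M≐cr c≡0 = M₁≢0 (trans (M≐cr i₁ j₁) (trans (cong (_⊗ rep k i₁ j₁) c≡0) (R.zeroˡ (rep k i₁ j₁))))
      other-k≡0 : ∀ k → k ≢ k₀ → sumOver (λ c → 𝟙 (M ≐? scale c (rep k))) ≡ 0
      other-k≡0 k k≢k₀ = sumOver-zero (λ c → 𝟙-no (M ≐? scale c (rep k))
        (λ M≐cr → k≢k₀ (rep-distinct k k₀ (scalar-transfer (scalar≢0 M≐cr) c₀≢0 M≐cr M≐c₀r))))
      other-c≡0 : ∀ c → c ≢ c₀ → 𝟙 (M ≐? scale c (rep k₀)) ≡ 0
      other-c≡0 c c≢c₀ with proj₁ (rep-rank1 k₀)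
      ... | i₂ , j₂ , r₂≢0 = 𝟙-no (M ≐? scale c (rep k₀))
        (λ M≐cr → c≢c₀ (⊗-cancelʳ r₂≢0 (trans (sym (M≐cr i₂ j₂)) (M≐c₀r i₂ j₂))))

    wt-eval-outer : ∀ (f : LinForm F ℓ m) u v → wt (eval F f (outer u v)) ≡
      sum (λ k → sumOver (λ c → wt c * wt (eval F f (rep k)) * 𝟙 (outer u v ≐? scale c (rep k))))
    wt-eval-outer f u v = sym (begin
      sum (λ k → sumOver (λ c → wt c * wt (eval F f (rep k)) * 𝟙 (M ≐? scale c (rep k))))
        ≡⟨ sum-cong (λ k → sumOver-cong (λ c → wt-eval-scale f c M (rep k))) ⟩
      sum (λ k → sumOver (λ c → wt (eval F f M) * 𝟙 (M ≐? scale c (rep k))))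
        ≡⟨ sum-cong (λ k → sumOver-*ˡ (wt (eval F f M)) (λ c → 𝟙 (M ≐? scale c (rep k)))) ⟩
      sum (λ k → wt (eval F f M) * sumOver (λ c → 𝟙 (M ≐? scale c (rep k))))
        ≡⟨ *-distribˡ-sum (wt (eval F f M)) (λ k → sumOver (λ c → 𝟙 (M ≐? scale c (rep k)))) ⟨
      wt (eval F f M) * sum (λ k → sumOver (λ c → 𝟙 (M ≐? scale c (rep k))))
        ≡⟨ wt-*-cong (eval F f M) (λ fM≢0 → scalar-representation-unique (rank1-outer f u v fM≢0)) ⟩
      wt (eval F f M) * 1
        ≡⟨ *-identityʳ (wt (eval F f M)) ⟩
      wt (eval F f M) ∎)
      where
      open ≡-Reasoning
      M : Mat F ℓ m
      M = outer u v

    sumVec²-term : ∀ (f : LinForm F ℓ m) k c →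
      sumVec ℓ (λ u → sumVec m (λ v → wt c * wt (eval F f (rep k)) * 𝟙 (outer u v ≐? scale c (rep k))))
        ≡ wt c * (wt (eval F f (rep k)) * (q ∸ 1))
    sumVec²-term f k c = begin
      sumVec ℓ (λ u → sumVec m (λ v → w * 𝟙 (outer u v ≐? scale c (rep k))))
        ≡⟨ sumVec-cong ℓ (λ u → sumVec-*ˡ m w (λ v → 𝟙 (outer u v ≐? scale c (rep k)))) ⟩
      sumVec ℓ (λ u → w * sumVec m (λ v → 𝟙 (outer u v ≐? scale c (rep k))))
        ≡⟨ sumVec-*ˡ ℓ w (λ u → sumVec m (λ v → 𝟙 (outer u v ≐? scale c (rep k)))) ⟩
      wt c * wt (eval F f (rep k)) * sumVec ℓ (λ u → sumVec m (λ v → 𝟙 (outer u v ≐? scale c (rep k))))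
        ≡⟨ *-assoc (wt c) (wt (eval F f (rep k))) _ ⟩
      wt c * (wt (eval F f (rep k)) * sumVec ℓ (λ u → sumVec m (λ v → 𝟙 (outer u v ≐? scale c (rep k)))))
        ≡⟨ wt-*-cong c (λ c≢0 → cong (wt (eval F f (rep k)) *_) (sumVec²-outer≐-rank1 (rank1-scale c≢0 (rep-rank1 k)))) ⟩
      wt c * (wt (eval F f (rep k)) * (q ∸ 1)) ∎
      where
      open ≡-Reasoning
      w : ℕ
      w = wt c * wt (eval F f (rep k))

    pairCount-via-representatives : ∀ (f : LinForm F ℓ m) →
      pairCount f ≡ (q ∸ 1) * (q ∸ 1) * wH F (codeword F rep f)
    pairCount-via-representatives f = begin
      pairCount f
        ≡⟨ sumVec-cong ℓ (λ u → sumVec-cong m (wt-eval-outer f u)) ⟩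
      sumVec ℓ (λ u → sumVec m (λ v → sum (λ k → sumOver (λ c → X k c u v))))
        ≡⟨ sumVec²-sum-comm ℓ m (λ k u v → sumOver (λ c → X k c u v)) ⟩
      sum (λ k → sumVec ℓ (λ u → sumVec m (λ v → sumOver (λ c → X k c u v))))
        ≡⟨ sum-cong (λ k → sumVec²-sumOver-comm ℓ m (X k)) ⟩
      sum (λ k → sumOver (λ c → sumVec ℓ (λ u → sumVec m (X k c u))))
        ≡⟨ sum-cong (λ k → sumOver-cong (sumVec²-term f k)) ⟩
      sum (λ k → sumOver (λ c → wt c * (wt (e k) * (q ∸ 1))))
        ≡⟨ sum-cong (λ k → trans (sumOver-*ʳ (wt (e k) * (q ∸ 1)) wt) (cong (_* (wt (e k) * (q ∸ 1))) sumOver-wt)) ⟩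
      sum (λ k → (q ∸ 1) * (wt (e k) * (q ∸ 1)))
        ≡⟨ sum-cong (λ k → rearrange (q ∸ 1) (wt (e k))) ⟩
      sum (λ k → (q ∸ 1) * (q ∸ 1) * wt (e k))
        ≡⟨ *-distribˡ-sum ((q ∸ 1) * (q ∸ 1)) (wt ∘ e) ⟨
      (q ∸ 1) * (q ∸ 1) * sum (wt ∘ e)
        ≡⟨ cong ((q ∸ 1) * (q ∸ 1) *_) (wH≡sum-wt e) ⟨
      (q ∸ 1) * (q ∸ 1) * wH F e ∎
      where
      open ≡-Reasoning
      e : Fin n̂ → Carrier
      e = codeword F rep f
      X : Fin n̂ → Carrier → Vec Carrier ℓ → Vec Carrier m → ℕ
      X k c u v = wt c * wt (e k) * 𝟙 (outer u v ≐? scale c (rep k))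
      rearrange : ∀ Q w → Q * (w * Q) ≡ Q * Q * w
      rearrange = solve-∀

  wH≡ŵ : ∀ {ℓ m n̂} (rep : Fin n̂ → Mat F (suc ℓ) (suc m)) → IsRank1Representatives F rep →
    ∀ f {d} → d ≤ suc ℓ → sumVec (suc ℓ) (λ u → 𝟙 (leftKernel? f u)) ≡ q ^ d →
    wH F (codeword F rep f) ≡ ŵ q (suc ℓ) (suc m) (suc ℓ ∸ d)
  wH≡ŵ {ℓ} {m} rep isRep f {d} d≤ℓ kernel≡q^d = ŵ-from-counts q ℓ m d 1<q d≤ℓ [q∸1]W≡q^mN N+q^d≡q^ℓ
    where
    open Representatives rep isRep
    W N : ℕ
    W = wH F (codeword F rep f)
    N = sumVec (suc ℓ) (λ u → 𝟙 (¬? (leftKernel? f u)))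
    [q∸1]W≡q^mN : (q ∸ 1) * W ≡ q ^ m * N
    [q∸1]W≡q^mN = *-cancelˡ-≡ _ _ (q ∸ 1) {{>-nonZero (m<n⇒0<n∸m 1<q)}} (begin
      (q ∸ 1) * ((q ∸ 1) * W)   ≡⟨ *-assoc (q ∸ 1) (q ∸ 1) W ⟨
      (q ∸ 1) * (q ∸ 1) * W     ≡⟨ pairCount-via-representatives f ⟨
      pairCount f               ≡⟨ pairCount-via-leftKernel f ⟩
      (q ∸ 1) * q ^ m * N       ≡⟨ *-assoc (q ∸ 1) (q ^ m) N ⟩
      (q ∸ 1) * (q ^ m * N)     ∎)
      where open ≡-Reasoning
    N+q^d≡q^ℓ : N + q ^ d ≡ q ^ suc ℓ
    N+q^d≡q^ℓ = trans (cong (N +_) (sym kernel≡q^d)) (sumVec-complement (suc ℓ) (leftKernel? f))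

theorem4p2 : (q : ℕ) → IsPrimePower q → (F : FiniteField q) →
    (ℓ m : ℕ) → 1 ≤ ℓ → ℓ ≤ m →
    (n̂ : ℕ) → (rep : Fin n̂ → Mat F ℓ m) → IsRank1Representatives F rep →
      -- every nonzero weight is one of ŵ_1, …, ŵ_ℓ
      ((f : LinForm F ℓ m) → wH F (codeword F rep f) ≢ 0 →
         Σ ℕ λ r → 1 ≤ r × r ≤ ℓ × wH F (codeword F rep f) ≡ ŵ q ℓ m r)
      -- ŵ_r = w_H(ĉ_{τ_r}) and ŵ_r = q^(ℓ+m-r-1) (q^r - 1)/(q - 1)
    × ((r : ℕ) → 1 ≤ r → r ≤ ℓ →
         wH F (codeword F rep (τ F r)) ≡ ŵ q ℓ m r
         × ŵ q ℓ m r * (q ∸ 1) ≡ q ^ (ℓ + m ∸ r ∸ 1) * (q ^ r ∸ 1))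
      -- ŵ_1 < ŵ_2 < ⋯ < ŵ_ℓ
    × ((r s : ℕ) → 1 ≤ r → r < s → s ≤ ℓ → ŵ q ℓ m r < ŵ q ℓ m s)
      -- minimum distance q^(ℓ+m-2)
    × (Σ (LinForm F ℓ m) λ f → wH F (codeword F rep f) ≡ q ^ (ℓ + m ∸ 2))
    × ((f : LinForm F ℓ m) → wH F (codeword F rep f) ≢ 0 →
         q ^ (ℓ + m ∸ 2) ≤ wH F (codeword F rep f))
theorem4p2 q _ F (suc ℓ) (suc m) (s≤s z≤n) ℓ≤m n̂ rep isRep =
  nonzero-weights , τ-weights , (λ _ _ _ r<s _ → ŵ-strictMono q (suc ℓ) (suc m) 1≤q r<s) ,
  (τ F 1 , proj₁ (τ-weights 1 ≤-refl (s≤s z≤n))) , minimum-distance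
  where
  open FieldCounting F

  1≤q : 1 ≤ q
  1≤q = <⇒≤ 1<q

  W : LinForm F (suc ℓ) (suc m) → ℕ
  W f = wH F (codeword F rep f)

  nonzero-weights : ∀ f → W f ≢ 0 → Σ ℕ λ r → 1 ≤ r × r ≤ suc ℓ × W f ≡ ŵ q (suc ℓ) (suc m) r
  nonzero-weights f W≢0 with subspace-card (suc ℓ) (leftKernel? f) (leftKernel-subspace f)
  ... | d , d≤ℓ , kernel≡q^d = suc ℓ ∸ d , n≢0⇒n>0 (W≢0 ∘ r≡0⇒W≡0) , m∸n≤m (suc ℓ) d , W≡ŵ
    where
    W≡ŵ : W f ≡ ŵ q (suc ℓ) (suc m) (suc ℓ ∸ d)
    W≡ŵ = wH≡ŵ rep isRep f d≤ℓ kernel≡q^d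
    r≡0⇒W≡0 : suc ℓ ∸ d ≡ 0 → W f ≡ 0
    r≡0⇒W≡0 r≡0 = trans W≡ŵ (cong (ŵ q (suc ℓ) (suc m)) r≡0)

  τ-weights : ∀ r → 1 ≤ r → r ≤ suc ℓ →
    W (τ F r) ≡ ŵ q (suc ℓ) (suc m) r × ŵ q (suc ℓ) (suc m) r * (q ∸ 1) ≡ q ^ (suc ℓ + suc m ∸ r ∸ 1) * (q ^ r ∸ 1)
  τ-weights r _ r≤ℓ =
    trans (wH≡ŵ rep isRep (τ F r) (m∸n≤m (suc ℓ) r) (sumVec-leftKernel-τ ℓ≤m r r≤ℓ))
          (cong (ŵ q (suc ℓ) (suc m)) (m∸[m∸n]≡n r≤ℓ)) ,
    ŵ-closed-form q ℓ m r 1≤q r≤ℓ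

  minimum-distance : ∀ f → W f ≢ 0 → q ^ (suc ℓ + suc m ∸ 2) ≤ W f
  minimum-distance f W≢0 = ≤-trans (ŵ-mono-≤ q (suc ℓ) (suc m) 1≤q 1≤r) (≤-reflexive (sym W≡ŵ))
    where
    weight : Σ ℕ λ r → 1 ≤ r × r ≤ suc ℓ × W f ≡ ŵ q (suc ℓ) (suc m) r
    weight = nonzero-weights f W≢0
    r : ℕ
    r = proj₁ weight
    1≤r : 1 ≤ r
    1≤r = proj₁ (proj₂ weight)
    W≡ŵ : W f ≡ ŵ q (suc ℓ) (suc m) r
    W≡ŵ = proj₂ (proj₂ (proj₂ weight))
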